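{- The notion of reduction $\beta_c\cup\mathit{id}$ is Church–Rosser: for all computations $M,N,L$, if $M\longrightarrow^*_{\beta_c,\mathit{id}}N$ and $M\longrightarrow^*_{\beta_c,\mathit{id}}L$, then there is a computation $M'$ with $N\longrightarrow^*_{\beta_c,\mathit{id}}M'$ and $L\longrightarrow^*_{\beta_c,\mathit{id}}M'$.
   Context: Syntax of $\lambda_c^u$: values $V ::= x\mid \lambda x.M$, computations $M ::= \mathit{unit}\,V\mid M\star V$ (up to renaming of bound variables; $M[V/x]$ capture-avoiding substitution). $\beta_c$ is the set of pairs $(\mathit{unit}\,V\star(\lambda x.M),\ M[V/x])$ and $\mathit{id}$ the set of pairs $(M\star\lambda x.\mathit{unit}\,x,\ M)$. For a notion of reduction $R$, $\longrightarrow_R$ is its compatible closure: if $(M,M')\in R$ then $\mathcal C[M]\longrightarrow_R\mathcal C[M']$ for every computation context, where value contexts are $\mathcal V ::= [\cdot]\mid\lambda x.\mathcal C$ and computation contexts are $\mathcal C ::= [\cdot]\mid\mathit{unit}\,\mathcal V\mid\mathcal C\star V\mid M\star\mathcal V$. $\longrightarrow^*_{\beta_c,\mathit{id}}$ is the reflexive–transitive closure of $\longrightarrow_{\beta_c\cup\mathit{id}}$. -}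

module Defs where

-- Syntax of lambda_c^u, well-scoped de Bruijn representation:
-- terms are taken up to renaming of bound variables (alpha-equivalence
-- is syntactic equality with de Bruijn indices).

open import Data.Nat using (ℕ; zero; suc)
open import Data.Fin using (Fin; zero; suc)
open import Relation.Binary.Construct.Closure.ReflexiveTransitive using (Star)

mutual
  data Val (n : ℕ) : Set where
    var : Fin n → Val n
    lam : Comp (suc n) → Val n

  data Comp (n : ℕ) : Set where
    unit : Val n → Comp n
    _⋆_  : Comp n → Val n → Comp n

infixl 5 _⋆_

Ren : ℕ → ℕ → Set
Ren m n = Fin m → Fin n

liftRen : ∀ {m n} → Ren m n → Ren (suc m) (suc n)
liftRen ρ zero    = zero
liftRen ρ (suc i) = suc (ρ i)

mutual
  renV : ∀ {m n} → Ren m n → Val m → Val n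
  renV ρ (var i) = var (ρ i)
  renV ρ (lam M) = lam (renC (liftRen ρ) M)

  renC : ∀ {m n} → Ren m n → Comp m → Comp n
  renC ρ (unit V) = unit (renV ρ V)
  renC ρ (M ⋆ V)  = renC ρ M ⋆ renV ρ V

Sub : ℕ → ℕ → Set
Sub m n = Fin m → Val n

liftSub : ∀ {m n} → Sub m n → Sub (suc m) (suc n)
liftSub σ zero    = var zero
liftSub σ (suc i) = renV suc (σ i)

mutual
  subV : ∀ {m n} → Sub m n → Val m → Val n
  subV σ (var i) = σ i
  subV σ (lam M) = lam (subC (liftSub σ) M)

  subC : ∀ {m n} → Sub m n → Comp m → Comp n
  subC σ (unit V) = unit (subV σ V)
  subC σ (M ⋆ V)  = subC σ M ⋆ subV σ V

single : ∀ {n} → Val n → Sub (suc n) n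
single V zero    = V
single V (suc i) = var i

_[_/0] : ∀ {n} → Comp (suc n) → Val n → Comp n
M [ V /0] = subC (single V) M

data βc {n : ℕ} : Comp n → Comp n → Set where
  beta : (V : Val n) (M : Comp (suc n)) → βc (unit V ⋆ lam M) (M [ V /0])

data idR {n : ℕ} : Comp n → Comp n → Set where
  eta : (M : Comp n) → idR (M ⋆ lam (unit (var zero))) M

data βcId {n : ℕ} (M N : Comp n) : Set where
  inβ  : βc M N  → βcId M N
  inid : idR M N → βcId M N

mutual
  data _⟶C_ {n : ℕ} : Comp n → Comp n → Set where
    root  : ∀ {M N} → βcId M N → M ⟶C N
    unitV : ∀ {V W} → V ⟶V W → unit V ⟶C unit W
    starL : ∀ {M N V} → M ⟶C N → (M ⋆ V) ⟶C (N ⋆ V)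
    starR : ∀ {M V W} → V ⟶V W → (M ⋆ V) ⟶C (M ⋆ W)

  data _⟶V_ {n : ℕ} : Val n → Val n → Set where
    lamC : ∀ {M N : Comp (suc n)} → M ⟶C N → lam M ⟶V lam N

infix 4 _⟶C_ _⟶V_ _⟶*_

_⟶*_ : ∀ {n} → Comp n → Comp n → Set
_⟶*_ = Star _⟶C_

-- Tait–Martin-Löf: parallel reduction ⇒, which contracts any set of the βc- and
-- id-redexes of a term at once, lies between ⟶ and ⟶*, so both have the same
-- reflexive–transitive closure; and ⇒ has the diamond property. The only
-- overlap of βc and id is unit V ⋆ λx.unit x, whose two contracta are both unit V.
module Submission where

open import Defs
open import Data.Nat using (ℕ; zero; suc)
open import Data.Fin using (zero; suc)
open import Data.Product using (Σ; ∃; _×_; _,_)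
open import Function using (id)
open import Level using (Level; _⊔_)
open import Relation.Binary.Core using (Rel; _⇒_)
open import Relation.Binary.PropositionalEquality using (_≡_; refl; cong; cong₂; module ≡-Reasoning)
open import Relation.Binary.Construct.Closure.ReflexiveTransitive using (Star; ε; _◅_; _◅◅_; gmap; map; kleisliStar)
open import Relation.Binary.Rewriting using (Confluent)

module _ {a ℓ : Level} {A : Set a} (_⇉_ : Rel A ℓ) where

  Diamond : Set (a ⊔ ℓ)
  Diamond = ∀ {x y z} → x ⇉ y → x ⇉ z → ∃ λ w → (y ⇉ w) × (z ⇉ w)

module _ {a ℓ : Level} {A : Set a} {_⇉_ : Rel A ℓ} where

  strip : Diamond _⇉_ → ∀ {x y z} → x ⇉ y → Star _⇉_ x z → ∃ λ w → (Star _⇉_ y w) × (z ⇉ w)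
  strip diamond p ε = _ , ε , p
  strip diamond p (q ◅ qs) with diamond p q
  ... | _ , p′ , q′ with strip diamond q′ qs
  ... | w , r , s = w , p′ ◅ r , s

  diamond⇒confluent : Diamond _⇉_ → Confluent _⇉_
  diamond⇒confluent diamond ε        qs = _ , qs , ε
  diamond⇒confluent diamond (p ◅ ps) qs with strip diamond p qs
  ... | _ , ps′ , q′ with diamond⇒confluent diamond ps ps′
  ... | w , r , s = w , r , q′ ◅ s

module _ {a ℓ₁ ℓ₂ : Level} {A : Set a} {_⟶_ : Rel A ℓ₁} {_⇉_ : Rel A ℓ₂} where

  confluent-between : _⟶_ ⇒ _⇉_ → _⇉_ ⇒ Star _⟶_ → Confluent _⇉_ → Confluent _⟶_
  confluent-between ⟶⊆⇉ ⇉⊆⟶* confluent p q with confluent (map ⟶⊆⇉ p) (map ⟶⊆⇉ q)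
  ... | w , r , s = w , kleisliStar id ⇉⊆⟶* r , kleisliStar id ⇉⊆⟶* s

mutual
  renV∘renV : ∀ {a b c} {ρ : Ren b c} {ρ′ : Ren a b} {ρ″ : Ren a c} →
              (∀ i → ρ (ρ′ i) ≡ ρ″ i) → ∀ V → renV ρ (renV ρ′ V) ≡ renV ρ″ V
  renV∘renV H (var i) = cong var (H i)
  renV∘renV H (lam M) = cong lam (renC∘renC (λ { zero → refl ; (suc i) → cong suc (H i) }) M)

  renC∘renC : ∀ {a b c} {ρ : Ren b c} {ρ′ : Ren a b} {ρ″ : Ren a c} →
              (∀ i → ρ (ρ′ i) ≡ ρ″ i) → ∀ M → renC ρ (renC ρ′ M) ≡ renC ρ″ M
  renC∘renC H (unit V) = cong unit (renV∘renV H V)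
  renC∘renC H (M ⋆ V)  = cong₂ _⋆_ (renC∘renC H M) (renV∘renV H V)

mutual
  subV∘renV : ∀ {a b c} {σ : Sub b c} {ρ : Ren a b} {τ : Sub a c} →
              (∀ i → σ (ρ i) ≡ τ i) → ∀ V → subV σ (renV ρ V) ≡ subV τ V
  subV∘renV H (var i) = H i
  subV∘renV H (lam M) = cong lam (subC∘renC (λ { zero → refl ; (suc i) → cong (renV suc) (H i) }) M)

  subC∘renC : ∀ {a b c} {σ : Sub b c} {ρ : Ren a b} {τ : Sub a c} →
              (∀ i → σ (ρ i) ≡ τ i) → ∀ M → subC σ (renC ρ M) ≡ subC τ M
  subC∘renC H (unit V) = cong unit (subV∘renV H V)
  subC∘renC H (M ⋆ V)  = cong₂ _⋆_ (subC∘renC H M) (subV∘renV H V)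

mutual
  renV∘subV : ∀ {a b c} {ρ : Ren b c} {σ : Sub a b} {τ : Sub a c} →
              (∀ i → renV ρ (σ i) ≡ τ i) → ∀ V → renV ρ (subV σ V) ≡ subV τ V
  renV∘subV H (var i) = H i
  renV∘subV {ρ = ρ} {σ} {τ} H (lam M) = cong lam (renC∘subC lifted M)
    where
      open ≡-Reasoning
      lifted : ∀ i → renV (liftRen ρ) (liftSub σ i) ≡ liftSub τ i
      lifted zero    = refl
      lifted (suc i) = begin
        renV (liftRen ρ) (renV suc (σ i))  ≡⟨ renV∘renV (λ _ → refl) (σ i) ⟩
        renV (λ j → suc (ρ j)) (σ i)       ≡˘⟨ renV∘renV (λ _ → refl) (σ i) ⟩
        renV suc (renV ρ (σ i))            ≡⟨ cong (renV suc) (H i) ⟩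
        renV suc (τ i)                     ∎

  renC∘subC : ∀ {a b c} {ρ : Ren b c} {σ : Sub a b} {τ : Sub a c} →
              (∀ i → renV ρ (σ i) ≡ τ i) → ∀ M → renC ρ (subC σ M) ≡ subC τ M
  renC∘subC H (unit V) = cong unit (renV∘subV H V)
  renC∘subC H (M ⋆ V)  = cong₂ _⋆_ (renC∘subC H M) (renV∘subV H V)

mutual
  subV∘subV : ∀ {a b c} {σ : Sub b c} {τ : Sub a b} {υ : Sub a c} →
              (∀ i → subV σ (τ i) ≡ υ i) → ∀ V → subV σ (subV τ V) ≡ subV υ V
  subV∘subV H (var i) = H i
  subV∘subV {σ = σ} {τ} {υ} H (lam M) = cong lam (subC∘subC lifted M)
    where
      open ≡-Reasoning
      lifted : ∀ i → subV (liftSub σ) (liftSub τ i) ≡ liftSub υ i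
      lifted zero    = refl
      lifted (suc i) = begin
        subV (liftSub σ) (renV suc (τ i))  ≡⟨ subV∘renV (λ _ → refl) (τ i) ⟩
        subV (λ j → renV suc (σ j)) (τ i)  ≡˘⟨ renV∘subV (λ _ → refl) (τ i) ⟩
        renV suc (subV σ (τ i))            ≡⟨ cong (renV suc) (H i) ⟩
        renV suc (υ i)                     ∎

  subC∘subC : ∀ {a b c} {σ : Sub b c} {τ : Sub a b} {υ : Sub a c} →
              (∀ i → subV σ (τ i) ≡ υ i) → ∀ M → subC σ (subC τ M) ≡ subC υ M
  subC∘subC H (unit V) = cong unit (subV∘subV H V)
  subC∘subC H (M ⋆ V)  = cong₂ _⋆_ (subC∘subC H M) (subV∘subV H V)

mutual
  subV-var : ∀ {a} {σ : Sub a a} → (∀ i → σ i ≡ var i) → ∀ V → subV σ V ≡ V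
  subV-var H (var i) = H i
  subV-var H (lam M) = cong lam (subC-var (λ { zero → refl ; (suc i) → cong (renV suc) (H i) }) M)

  subC-var : ∀ {a} {σ : Sub a a} → (∀ i → σ i ≡ var i) → ∀ M → subC σ M ≡ M
  subC-var H (unit V) = cong unit (subV-var H V)
  subC-var H (M ⋆ V)  = cong₂ _⋆_ (subC-var H M) (subV-var H V)

renC-[/0] : ∀ {m n} (ρ : Ren m n) (N : Comp (suc m)) V →
            renC ρ (N [ V /0]) ≡ renC (liftRen ρ) N [ renV ρ V /0]
renC-[/0] ρ N V = begin
  renC ρ (N [ V /0])                               ≡⟨ renC∘subC (λ _ → refl) N ⟩
  subC (λ i → renV ρ (single V i)) N               ≡˘⟨ subC∘renC (λ { zero → refl ; (suc i) → refl }) N ⟩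
  renC (liftRen ρ) N [ renV ρ V /0]                ∎
  where open ≡-Reasoning

subC-[/0] : ∀ {m n} (σ : Sub m n) (N : Comp (suc m)) V →
            subC σ (N [ V /0]) ≡ subC (liftSub σ) N [ subV σ V /0]
subC-[/0] σ N V = begin
  subC σ (N [ V /0])                               ≡⟨ subC∘subC (λ _ → refl) N ⟩
  subC (λ i → subV σ (single V i)) N               ≡˘⟨ subC∘subC single-after-lift N ⟩
  subC (liftSub σ) N [ subV σ V /0]                ∎
  where
    open ≡-Reasoning
    single-after-lift : ∀ i → subV (single (subV σ V)) (liftSub σ i) ≡ subV σ (single V i)
    single-after-lift zero    = refl
    single-after-lift (suc i) = begin
      subV (single (subV σ V)) (renV suc (σ i))  ≡⟨ subV∘renV (λ _ → refl) (σ i) ⟩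
      subV var (σ i)                             ≡⟨ subV-var (λ _ → refl) (σ i) ⟩
      σ i                                        ∎

mutual
  data _⇒C_ {n : ℕ} : Comp n → Comp n → Set where
    punit : ∀ {V V′} → V ⇒V V′ → unit V ⇒C unit V′
    pstar : ∀ {M M′ V V′} → M ⇒C M′ → V ⇒V V′ → M ⋆ V ⇒C M′ ⋆ V′
    pbeta : ∀ {V V′ N N′} → V ⇒V V′ → N ⇒C N′ → unit V ⋆ lam N ⇒C N′ [ V′ /0]
    peta  : ∀ {M M′} → M ⇒C M′ → M ⋆ lam (unit (var zero)) ⇒C M′

  data _⇒V_ {n : ℕ} : Val n → Val n → Set where
    pvar : ∀ {i} → var i ⇒V var i
    plam : ∀ {M M′} → M ⇒C M′ → lam M ⇒V lam M′

infix 4 _⇒C_ _⇒V_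

mutual
  ⇒V-refl : ∀ {n} (V : Val n) → V ⇒V V
  ⇒V-refl (var i) = pvar
  ⇒V-refl (lam M) = plam (⇒C-refl M)

  ⇒C-refl : ∀ {n} (M : Comp n) → M ⇒C M
  ⇒C-refl (unit V) = punit (⇒V-refl V)
  ⇒C-refl (M ⋆ V)  = pstar (⇒C-refl M) (⇒V-refl V)

mutual
  renV-⇒ : ∀ {m n} (ρ : Ren m n) {V V′} → V ⇒V V′ → renV ρ V ⇒V renV ρ V′
  renV-⇒ ρ pvar     = pvar
  renV-⇒ ρ (plam p) = plam (renC-⇒ (liftRen ρ) p)

  renC-⇒ : ∀ {m n} (ρ : Ren m n) {M M′} → M ⇒C M′ → renC ρ M ⇒C renC ρ M′
  renC-⇒ ρ (punit p)   = punit (renV-⇒ ρ p)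
  renC-⇒ ρ (pstar p q) = pstar (renC-⇒ ρ p) (renV-⇒ ρ q)
  renC-⇒ ρ (pbeta {V′ = V′} {N′ = N′} p q) rewrite renC-[/0] ρ N′ V′ =
    pbeta (renV-⇒ ρ p) (renC-⇒ (liftRen ρ) q)
  renC-⇒ ρ (peta p)    = peta (renC-⇒ ρ p)

mutual
  subV-⇒ : ∀ {m n} {σ σ′ : Sub m n} → (∀ i → σ i ⇒V σ′ i) →
           ∀ {V V′} → V ⇒V V′ → subV σ V ⇒V subV σ′ V′
  subV-⇒ H (pvar {i}) = H i
  subV-⇒ H (plam p)   = plam (subC-⇒ (liftSub-⇒ H) p)

  subC-⇒ : ∀ {m n} {σ σ′ : Sub m n} → (∀ i → σ i ⇒V σ′ i) →
           ∀ {M M′} → M ⇒C M′ → subC σ M ⇒C subC σ′ M′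
  subC-⇒ H (punit p)   = punit (subV-⇒ H p)
  subC-⇒ H (pstar p q) = pstar (subC-⇒ H p) (subV-⇒ H q)
  subC-⇒ {σ′ = σ′} H (pbeta {V′ = V′} {N′ = N′} p q) rewrite subC-[/0] σ′ N′ V′ =
    pbeta (subV-⇒ H p) (subC-⇒ (liftSub-⇒ H) q)
  subC-⇒ H (peta p)    = peta (subC-⇒ H p)

  liftSub-⇒ : ∀ {m n} {σ σ′ : Sub m n} → (∀ i → σ i ⇒V σ′ i) → ∀ i → liftSub σ i ⇒V liftSub σ′ i
  liftSub-⇒ H zero    = pvar
  liftSub-⇒ H (suc i) = renV-⇒ suc (H i)

[/0]-⇒ : ∀ {n} {N N′ : Comp (suc n)} {V V′ : Val n} → N ⇒C N′ → V ⇒V V′ → N [ V /0] ⇒C N′ [ V′ /0]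
[/0]-⇒ p q = subC-⇒ single-⇒ p
  where
    single-⇒ : ∀ i → single _ i ⇒V single _ i
    single-⇒ zero    = q
    single-⇒ (suc i) = pvar

mutual
  ⇒V-diamond : ∀ {n} → Diamond (_⇒V_ {n})
  ⇒V-diamond pvar     pvar     = _ , pvar , pvar
  ⇒V-diamond (plam p) (plam q) with ⇒C-diamond p q
  ... | R , a , b = lam R , plam a , plam b

  ⇒C-diamond : ∀ {n} → Diamond (_⇒C_ {n})
  ⇒C-diamond (punit p) (punit q) with ⇒V-diamond p q
  ... | R , a , b = unit R , punit a , punit b
  ⇒C-diamond (pstar p p′) (pstar q q′) with ⇒C-diamond p q | ⇒V-diamond p′ q′
  ... | R , a , b | R′ , a′ , b′ = R ⋆ R′ , pstar a a′ , pstar b b′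
  ⇒C-diamond (pstar (punit p) (plam p′)) (pbeta q q′) with ⇒V-diamond p q | ⇒C-diamond p′ q′
  ... | R , a , b | R′ , a′ , b′ = R′ [ R /0] , pbeta a a′ , [/0]-⇒ b′ b
  ⇒C-diamond (pbeta p p′) (pstar (punit q) (plam q′)) with ⇒V-diamond p q | ⇒C-diamond p′ q′
  ... | R , a , b | R′ , a′ , b′ = R′ [ R /0] , [/0]-⇒ a′ a , pbeta b b′
  ⇒C-diamond (pbeta p p′) (pbeta q q′) with ⇒V-diamond p q | ⇒C-diamond p′ q′
  ... | R , a , b | R′ , a′ , b′ = R′ [ R /0] , [/0]-⇒ a′ a , [/0]-⇒ b′ b
  ⇒C-diamond (pstar p (plam (punit pvar))) (peta q) with ⇒C-diamond p q
  ... | R , a , b = R , peta a , b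
  ⇒C-diamond (peta p) (pstar q (plam (punit pvar))) with ⇒C-diamond p q
  ... | R , a , b = R , a , peta b
  ⇒C-diamond (peta p) (peta q) = ⇒C-diamond p q
  ⇒C-diamond (pbeta p (punit pvar)) (peta (punit q)) with ⇒V-diamond p q
  ... | R , a , b = unit R , punit a , punit b
  ⇒C-diamond (peta (punit p)) (pbeta q (punit pvar)) with ⇒V-diamond p q
  ... | R , a , b = unit R , punit a , punit b

mutual
  ⟶V⊆⇒V : ∀ {n} → _⟶V_ {n} ⇒ _⇒V_
  ⟶V⊆⇒V (lamC s) = plam (⟶C⊆⇒C s)

  ⟶C⊆⇒C : ∀ {n} → _⟶C_ {n} ⇒ _⇒C_
  ⟶C⊆⇒C (root (inβ (beta V M))) = pbeta (⇒V-refl V) (⇒C-refl M)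
  ⟶C⊆⇒C (root (inid (eta M)))   = peta (⇒C-refl M)
  ⟶C⊆⇒C (unitV s)               = punit (⟶V⊆⇒V s)
  ⟶C⊆⇒C (starL {V = V} s)       = pstar (⟶C⊆⇒C s) (⇒V-refl V)
  ⟶C⊆⇒C (starR {M = M} s)       = pstar (⇒C-refl M) (⟶V⊆⇒V s)

lam-cong* : ∀ {n} {M M′ : Comp (suc n)} → M ⟶* M′ → Star _⟶V_ (lam M) (lam M′)
lam-cong* = gmap lam lamC

unit-cong* : ∀ {n} {V V′ : Val n} → Star _⟶V_ V V′ → unit V ⟶* unit V′
unit-cong* = gmap unit unitV

⋆-cong* : ∀ {n} {M M′ : Comp n} {V V′} → M ⟶* M′ → Star _⟶V_ V V′ → M ⋆ V ⟶* M′ ⋆ V′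
⋆-cong* {M′ = M′} {V} p q = gmap (_⋆ V) starL p ◅◅ gmap (M′ ⋆_) starR q

mutual
  ⇒V⊆⟶V* : ∀ {n} → _⇒V_ {n} ⇒ Star _⟶V_
  ⇒V⊆⟶V* pvar     = ε
  ⇒V⊆⟶V* (plam p) = lam-cong* (⇒C⊆⟶* p)

  ⇒C⊆⟶* : ∀ {n} → _⇒C_ {n} ⇒ _⟶*_
  ⇒C⊆⟶* (punit p)   = unit-cong* (⇒V⊆⟶V* p)
  ⇒C⊆⟶* (pstar p q) = ⋆-cong* (⇒C⊆⟶* p) (⇒V⊆⟶V* q)
  ⇒C⊆⟶* (pbeta {V′ = V′} {N′ = N′} p q) =
    ⋆-cong* (unit-cong* (⇒V⊆⟶V* p)) (lam-cong* (⇒C⊆⟶* q)) ◅◅ root (inβ (beta V′ N′)) ◅ ε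
  ⇒C⊆⟶* (peta p)    = root (inid (eta _)) ◅ ⇒C⊆⟶* p

mainTheorem14 : ∀ {n : ℕ} (M N L : Comp n) → M ⟶* N → M ⟶* L → Σ (Comp n) (λ M′ → (N ⟶* M′) × (L ⟶* M′))
mainTheorem14 _ _ _ = confluent-between ⟶C⊆⇒C ⇒C⊆⟶* (diamond⇒confluent ⇒C-diamond)
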